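{- For any numerical set $S$, we have $S^{(c_1(S))}=\mathbb{N}$.
   Context: $\mathbb{N}=\{0,1,2,\dots\}$. A numerical set is a subset $S\subseteq\mathbb{N}$ with $0\in S$ and $\mathbb{N}\setminus S$ finite. Its gaps are the elements of $\mathbb{N}\setminus S$, and $F(S)$ is its largest gap. Young diagram of $S$: it has one left-justified row for each gap $\ell$. The top row corresponds to $F(S)$, and the gaps decrease going down. The row for $\ell$ has length $|\{s\in S\mid s<\ell\}|$. This is a bijection between numerical sets and Young diagrams, with $\mathbb{N}$ corresponding to the empty diagram. The complement of a Young diagram with rows $\lambda_1\ge\dots\ge\lambda_g$ has rows $\lambda_1-\lambda_g\ge\dots\ge\lambda_1-\lambda_1$, zero rows being discarded. Geometrically, this is the rest of the $g\times\lambda_1$ rectangle rotated by $180^\circ$. The complement $\widetilde{S}$ is the numerical set whose Young diagram is the complement of that of $S$. Iterated complements are defined by $S^{(0)}=S$ and $S^{(i+1)}=\widetilde{S^{(i)}}$ (for $S^{(i)}\neq\mathbb{N}$). The hook of a box consists of the box together with all boxes to its right in its row and all boxes below it in its column. Its hook length is the number of boxes in the hook. $c_1(S)$ is the number of boxes with hook length $1$ in the Young diagram of $S$. -}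

module Defs where

open import Data.Bool using (Bool; true; false; not; _∨_; if_then_else_; T)
open import Data.Unit using (tt)
open import Data.Bool.Properties using (∨-zeroʳ)
open import Data.Nat using (ℕ; zero; suc; _+_; _∸_; _≤_; _<_; _<ᵇ_; _≡ᵇ_; _⊔_; z≤n; s≤s)
open import Data.Nat.Properties using (≤-trans; m≤m⊔n; m≤n⊔m; <⇒≢; ≡ᵇ⇒≡; n≤1+n)
open import Data.List using (List; []; _∷_; length; map; filterᵇ; upTo; reverse; _++_)
open import Function using (_∘_)
open import Relation.Binary.PropositionalEquality using (_≡_; refl; sym)

-- Numerical sets: S ⊆ ℕ (given by a Boolean membership test) with
-- 0 ∈ S and ℕ ∖ S finite (every n ≥ bound lies in S).

record NumericalSet : Set where
  field
    mem      : ℕ → Bool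
    mem0     : mem 0 ≡ true
    bound    : ℕ
    cofinite : ∀ n → bound ≤ n → mem n ≡ true
open NumericalSet public

IsℕSet : NumericalSet → Set
IsℕSet S = ∀ n → mem S n ≡ true

-- gaps of S, in decreasing order (top row first)
gapsDesc : NumericalSet → List ℕ
gapsDesc S = reverse (filterᵇ (not ∘ mem S) (upTo (bound S)))

countBelow : NumericalSet → ℕ → ℕ
countBelow S ℓ = length (filterᵇ (mem S) (upTo ℓ))

-- A Young diagram is the list of its row lengths, top row first.
YoungDiagram : Set
YoungDiagram = List ℕ

young : NumericalSet → YoungDiagram
young S = map (countBelow S) (gapsDesc S)

complementDiagram : YoungDiagram → YoungDiagram
complementDiagram [] = []
complementDiagram (l₁ ∷ ls) =
  filterᵇ (λ r → 0 <ᵇ r) (reverse (map (l₁ ∸_) (l₁ ∷ ls)))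

-- If the rows read bottom-up are μ₀ ≤ μ₁ ≤ …, the j-th gap from below is
-- μ_j + j (a gap ℓ has λ = #(S below ℓ) and #(gaps below ℓ) below it).

gapsFromBottomUp : ℕ → List ℕ → List ℕ
gapsFromBottomUp j []       = []
gapsFromBottomUp j (μ ∷ μs) = (μ + j) ∷ gapsFromBottomUp (suc j) μs

gapsOfDiagram : YoungDiagram → List ℕ
gapsOfDiagram ls = gapsFromBottomUp 0 (reverse ls)

elemᵇ : ℕ → List ℕ → Bool
elemᵇ n []       = false
elemᵇ n (x ∷ xs) = (n ≡ᵇ x) ∨ elemᵇ n xs

maxL : List ℕ → ℕ
maxL []       = 0
maxL (x ∷ xs) = x ⊔ maxL xs

private
  T-true : ∀ {b} → b ≡ true → T b
  T-true refl = tt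

  ≡ᵇ-false : ∀ n x → x < n → (n ≡ᵇ x) ≡ false
  ≡ᵇ-false n x x<n with n ≡ᵇ x in eq
  ... | false = refl
  ... | true  with () ← <⇒≢ x<n (sym (≡ᵇ⇒≡ n x (T-true eq)))

  elem-out : ∀ n xs → suc (maxL xs) ≤ n → elemᵇ n xs ≡ false
  elem-out n []       _ = refl
  elem-out n (x ∷ xs) p
    rewrite ≡ᵇ-false n x (≤-trans (s≤s (m≤m⊔n x (maxL xs))) p)
    = elem-out n xs (≤-trans (s≤s (m≤n⊔m x (maxL xs))) p)

-- membership: n = 0, or n is not one of the gaps (the gaps of a diagram
-- with positive rows are all positive, so the "n = 0" clause is harmless)
fromGaps : List ℕ → NumericalSet
fromGaps G = record
  { mem      = λ n → (n ≡ᵇ 0) ∨ not (elemᵇ n G)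
  ; mem0     = refl
  ; bound    = suc (maxL G)
  ; cofinite = λ n p → helper n p
  }
  where
    helper : ∀ n → suc (maxL G) ≤ n → ((n ≡ᵇ 0) ∨ not (elemᵇ n G)) ≡ true
    helper n p rewrite elem-out n G p = ∨-zeroʳ (n ≡ᵇ 0)

fromDiagram : YoungDiagram → NumericalSet
fromDiagram ls = fromGaps (gapsOfDiagram ls)

complement : NumericalSet → NumericalSet
complement S = fromDiagram (complementDiagram (young S))

-- S^(k); note complement ℕ = ℕ (empty diagram), so this is total
iterComplement : ℕ → NumericalSet → NumericalSet
iterComplement zero    S = S
iterComplement (suc k) S = complement (iterComplement k S)

countGreater : ℕ → List ℕ → ℕ
countGreater j []       = 0
countGreater j (r ∷ rs) = if j <ᵇ r then suc (countGreater j rs) else countGreater j rs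

-- hook lengths of all boxes of a diagram (top row first);
-- box in column j (0-indexed) of a row of length r with rows rs below:
-- arm = r - j - 1, leg = #{rows below of length > j}, hook = arm + leg + 1
hookLengths : YoungDiagram → List ℕ
hookLengths []       = []
hookLengths (r ∷ rs) =
  map (λ j → suc ((r ∸ suc j) + countGreater j rs)) (upTo r) ++ hookLengths rs

c₁ : NumericalSet → ℕ
c₁ S = length (filterᵇ (_≡ᵇ 1) (hookLengths (young S)))

-- c₁(S) counts the outer corners of the Young diagram of S, i.e. its distinct row
-- lengths. If the longest row has length l, the complement deletes the rows of length l
-- and replaces every other row length r by l − r, which is injective; so each complement
-- removes exactly one corner, and after c₁(S) steps the diagram is empty, i.e. the set is ℕ.
-- Counting corners as the jumps in the sequence of row lengths followed by 0 makes the
-- invariance under the reflection r ↦ l − r and under reversing the row order evident.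

module Submission where

open import Defs
open import Data.Bool using (Bool; true; false; not; if_then_else_; T; T?)
open import Data.Bool.Properties using (not-involutive)
open import Data.Product using (∃₂; _×_; _,_; proj₂)
open import Data.Sum using (inj₁; inj₂)
open import Data.Nat
open import Data.Nat.Properties
open import Data.List
open import Data.List.Properties
open import Data.List.Membership.Propositional using (lose)
open import Data.List.Relation.Unary.Any using (Any)
open import Data.List.Membership.Propositional.Properties using (∈-upTo⁺)
open import Data.List.Relation.Unary.All as All using (All; []; _∷_)
import Data.List.Relation.Unary.All.Properties as All
open import Data.List.Relation.Unary.AllPairs as AllPairs using (AllPairs; []; _∷_)
import Data.List.Relation.Unary.AllPairs.Properties as AllPairs
open import Function using (_∘_; id; flip; case_of_)
open import Relation.Binary.PropositionalEquality
open import Relation.Nullary using (¬_; yes; no; contradiction)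
open import Relation.Nullary.Decidable using (dec-true; dec-false)
open import Relation.Binary.Definitions using (tri<; tri≈; tri>)

All-reverse : ∀ {A : Set} {P : A → Set} {xs} → All P xs → All P (reverse xs)
All-reverse {xs = []}     []         = []
All-reverse {xs = x ∷ xs} (px ∷ pxs) rewrite unfold-reverse x xs =
  All.∷ʳ⁺ (All-reverse pxs) px

AllPairs-∷ʳ : ∀ {A : Set} {R : A → A → Set} {xs x} →
  AllPairs R xs → All (λ y → R y x) xs → AllPairs R (xs ∷ʳ x)
AllPairs-∷ʳ Rxs Rx = AllPairs.++⁺ Rxs ([] ∷ []) (All.map (_∷ []) Rx)

AllPairs-reverse : ∀ {A : Set} {R : A → A → Set} {xs} →
  AllPairs R xs → AllPairs (flip R) (reverse xs)
AllPairs-reverse {xs = []}     []          = []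
AllPairs-reverse {xs = x ∷ xs} (Rx ∷ Rxs) rewrite unfold-reverse x xs =
  AllPairs-∷ʳ (AllPairs-reverse Rxs) (All-reverse Rx)

<ᵇ-true : ∀ {m n} → m < n → (m <ᵇ n) ≡ true
<ᵇ-true = dec-true (_ <? _)

<ᵇ-false : ∀ {m n} → n ≤ m → (m <ᵇ n) ≡ false
<ᵇ-false n≤m = dec-false (_ <? _) (≤⇒≯ n≤m)

≡ᵇ-refl : ∀ n → (n ≡ᵇ n) ≡ true
≡ᵇ-refl n = dec-true (n ≟ n) refl

≡ᵇ-false : ∀ {m n} → m ≢ n → (m ≡ᵇ n) ≡ false
≡ᵇ-false = dec-false (_ ≟ _)

differ : ℕ → ℕ → ℕ
differ m n = if m ≡ᵇ n then 0 else 1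

differ-refl : ∀ n → differ n n ≡ 0
differ-refl n rewrite ≡ᵇ-refl n = refl

differ-≢ : ∀ {m n} → m ≢ n → differ m n ≡ 1
differ-≢ m≢n rewrite ≡ᵇ-false m≢n = refl

differ-sym : ∀ m n → differ m n ≡ differ n m
differ-sym m n with m ≟ n
... | yes refl = refl
... | no m≢n   = trans (differ-≢ m≢n) (sym (differ-≢ (m≢n ∘ sym)))

differ-injective : ∀ (f : ℕ → ℕ) {m n} → (f m ≡ f n → m ≡ n) → differ (f m) (f n) ≡ differ m n
differ-injective f {m} {n} inj with m ≟ n
... | yes refl = trans (differ-refl (f m)) (sym (differ-refl m))
... | no m≢n   = trans (differ-≢ (m≢n ∘ inj)) (sym (differ-≢ m≢n))

jumps : ℕ → List ℕ → ℕ
jumps p []       = 0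
jumps p (x ∷ xs) = differ p x + jumps x xs

jumps-∷ʳ-∷ʳ : ∀ p xs x y → jumps p (xs ∷ʳ x ∷ʳ y) ≡ jumps p (xs ∷ʳ x) + differ x y
jumps-∷ʳ-∷ʳ p []       x y = cong₂ _+_ (sym (+-identityʳ (differ p x))) (+-identityʳ (differ x y))
jumps-∷ʳ-∷ʳ p (z ∷ zs) x y rewrite jumps-∷ʳ-∷ʳ z zs x y = sym (+-assoc (differ p z) _ _)

jumps-reverse : ∀ p xs q → jumps p (xs ∷ʳ q) ≡ jumps q (reverse xs ∷ʳ p)
jumps-reverse p []       q = cong (_+ 0) (differ-sym p q)
jumps-reverse p (x ∷ xs) q = begin
  differ p x + jumps x (xs ∷ʳ q)                 ≡⟨ cong (differ p x +_) (jumps-reverse x xs q) ⟩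
  differ p x + jumps q (reverse xs ∷ʳ x)         ≡⟨ +-comm (differ p x) _ ⟩
  jumps q (reverse xs ∷ʳ x) + differ p x         ≡⟨ cong (jumps q (reverse xs ∷ʳ x) +_) (differ-sym p x) ⟩
  jumps q (reverse xs ∷ʳ x) + differ x p         ≡⟨ jumps-∷ʳ-∷ʳ q (reverse xs) x p ⟨
  jumps q (reverse xs ∷ʳ x ∷ʳ p)                 ≡⟨ cong (λ ys → jumps q (ys ∷ʳ p)) (unfold-reverse x xs) ⟨
  jumps q (reverse (x ∷ xs) ∷ʳ p)                ∎
  where open ≡-Reasoning

jumps-map : ∀ (f : ℕ → ℕ) {P : ℕ → Set} → (∀ {m n} → P m → P n → f m ≡ f n → m ≡ n) →
  ∀ {p xs} → P p → All P xs → jumps (f p) (map f xs) ≡ jumps p xs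
jumps-map f inj Pp []         = refl
jumps-map f inj Pp (Px ∷ Pxs) =
  cong₂ _+_ (differ-injective f (inj Pp Px)) (jumps-map f inj Px Pxs)

jumps-∷ʳ-fresh : ∀ {p xs q} → All (_≢ q) (p ∷ xs) → jumps p (xs ∷ʳ q) ≡ suc (jumps p xs)
jumps-∷ʳ-fresh {xs = []}     (p≢q ∷ [])   = cong (_+ 0) (differ-≢ p≢q)
jumps-∷ʳ-fresh {p} {x ∷ xs} (_ ∷ fresh) =
  trans (cong (differ p x +_) (jumps-∷ʳ-fresh fresh)) (+-suc (differ p x) _)

jumps-replicate : ∀ x k ys → jumps x (replicate k x ++ ys) ≡ jumps x ys
jumps-replicate x zero    ys = refl
jumps-replicate x (suc k) ys rewrite differ-refl x = jumps-replicate x k ys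

Descending : List ℕ → Set
Descending = AllPairs _≥_

IsPartition : YoungDiagram → Set
IsPartition D = Descending D × All (1 ≤_) D

head₀ : List ℕ → ℕ
head₀ []      = 0
head₀ (x ∷ _) = x

-- In a partition, the last box of a row is an outer corner iff the row below is shorter.
corners : YoungDiagram → ℕ
corners []       = 0
corners (r ∷ rs) = differ r (head₀ rs) + corners rs

corners-∷≡jumps : ∀ r rs → corners (r ∷ rs) ≡ jumps r (rs ∷ʳ 0)
corners-∷≡jumps r []       = refl
corners-∷≡jumps r (s ∷ ss) = cong (differ r s +_) (corners-∷≡jumps s ss)

corners≡jumps-reverse : ∀ D → corners D ≡ jumps 0 (reverse D)
corners≡jumps-reverse []       = refl
corners≡jumps-reverse (r ∷ rs) = begin
  corners (r ∷ rs)            ≡⟨ corners-∷≡jumps r rs ⟩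
  jumps r (rs ∷ʳ 0)           ≡⟨ jumps-reverse r rs 0 ⟩
  jumps 0 (reverse rs ∷ʳ r)   ≡⟨ cong (jumps 0) (unfold-reverse r rs) ⟨
  jumps 0 (reverse (r ∷ rs))  ∎
  where open ≡-Reasoning

corners≡0⇒≡[] : ∀ {D} → All (1 ≤_) D → corners D ≡ 0 → D ≡ []
corners≡0⇒≡[] []                    _   = refl
corners≡0⇒≡[] {suc r ∷ rs} (_ ∷ pos) c≡0
  with refl ← corners≡0⇒≡[] pos (m+n≡0⇒n≡0 (differ (suc r) (head₀ rs)) c≡0) = case c≡0 of λ ()

hookOnes : YoungDiagram → ℕ
hookOnes D = length (filterᵇ (_≡ᵇ 1) (hookLengths D))

countGreater-≤ : ∀ {j rs} → All (_≤ j) rs → countGreater j rs ≡ 0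
countGreater-≤ []                       = refl
countGreater-≤ (r≤j ∷ rs≤j) rewrite <ᵇ-false r≤j = countGreater-≤ rs≤j

boxHook : ℕ → List ℕ → ℕ → ℕ
boxHook r rs j = suc ((r ∸ suc j) + countGreater j rs)

boxHook≢1 : ∀ {r rs j} → j < r → ¬ T (boxHook (suc r) rs j ≡ᵇ 1)
boxHook≢1 {r} {j = j} j<r hook≡1 =
  <⇒≱ j<r (m∸n≡0⇒m≤n (m+n≡0⇒m≡0 (r ∸ j) (suc-injective (≡ᵇ⇒≡ _ 1 hook≡1))))

lastBoxHookOne : ∀ r rs → All (_≤ suc r) rs → Descending rs →
  length (filterᵇ (_≡ᵇ 1) (suc (countGreater r rs) ∷ [])) ≡ differ (suc r) (head₀ rs)
lastBoxHookOne r []       _              _           = refl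
lastBoxHookOne r (y ∷ ys) (y≤1+r ∷ _) (ys≤y ∷ _) with m≤n⇒m<n∨m≡n y≤1+r
... | inj₁ (s≤s y≤r) rewrite countGreater-≤ (y≤r ∷ All.map (λ z≤y → ≤-trans z≤y y≤r) ys≤y) =
  sym (differ-≢ (λ 1+r≡y → <⇒≢ (s≤s y≤r) (sym 1+r≡y)))
... | inj₂ refl rewrite <ᵇ-true (n<1+n r) = sym (differ-refl (suc r))

-- Inner boxes have a positive arm; the last box has leg 0 iff the next row is shorter.
rowHookOnes : ∀ r rs → All (_≤ suc r) rs → Descending rs →
  length (filterᵇ (_≡ᵇ 1) (map (boxHook (suc r) rs) (upTo (suc r)))) ≡ differ (suc r) (head₀ rs)
rowHookOnes r rs rs≤1+r desc = begin
  length (filterᵇ (_≡ᵇ 1) (map hook (upTo (suc r))))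
    ≡⟨ cong (length ∘ filterᵇ (_≡ᵇ 1) ∘ map hook) (upTo-∷ʳ r) ⟨
  length (filterᵇ (_≡ᵇ 1) (map hook (upTo r ∷ʳ r)))
    ≡⟨ cong (length ∘ filterᵇ (_≡ᵇ 1)) (map-++ hook (upTo r) (r ∷ [])) ⟩
  length (filterᵇ (_≡ᵇ 1) (map hook (upTo r) ++ hook r ∷ []))
    ≡⟨ cong length (filter-++ (T? ∘ (_≡ᵇ 1)) (map hook (upTo r)) (hook r ∷ [])) ⟩
  length (filterᵇ (_≡ᵇ 1) (map hook (upTo r)) ++ filterᵇ (_≡ᵇ 1) (hook r ∷ []))
    ≡⟨ cong (λ xs → length (xs ++ filterᵇ (_≡ᵇ 1) (hook r ∷ []))) innerBoxes ⟩
  length (filterᵇ (_≡ᵇ 1) (hook r ∷ []))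
    ≡⟨ cong (λ k → length (filterᵇ (_≡ᵇ 1) (suc (k + countGreater r rs) ∷ []))) (n∸n≡0 r) ⟩
  length (filterᵇ (_≡ᵇ 1) (suc (countGreater r rs) ∷ []))
    ≡⟨ lastBoxHookOne r rs rs≤1+r desc ⟩
  differ (suc r) (head₀ rs) ∎
  where
  open ≡-Reasoning
  hook : ℕ → ℕ
  hook = boxHook (suc r) rs
  innerBoxes : filterᵇ (_≡ᵇ 1) (map hook (upTo r)) ≡ []
  innerBoxes = filter-none (T? ∘ (_≡ᵇ 1)) (All.map⁺ (All.applyUpTo⁺₁ id r (boxHook≢1 {rs = rs})))

hookOnes≡corners : ∀ {D} → IsPartition D → hookOnes D ≡ corners D
hookOnes≡corners {[]}         _                             = refl
hookOnes≡corners {suc r ∷ rs} ((rs≤r ∷ desc) , (_ ∷ pos)) = begin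
  length (filterᵇ (_≡ᵇ 1) (rowHooks ++ hookLengths rs))
    ≡⟨ cong length (filter-++ (T? ∘ (_≡ᵇ 1)) rowHooks (hookLengths rs)) ⟩
  length (filterᵇ (_≡ᵇ 1) rowHooks ++ filterᵇ (_≡ᵇ 1) (hookLengths rs))
    ≡⟨ length-++ (filterᵇ (_≡ᵇ 1) rowHooks) ⟩
  length (filterᵇ (_≡ᵇ 1) rowHooks) + hookOnes rs
    ≡⟨ cong₂ _+_ (rowHookOnes r rs rs≤r desc) (hookOnes≡corners (desc , pos)) ⟩
  differ (suc r) (head₀ rs) + corners rs ∎
  where
  open ≡-Reasoning
  rowHooks : List ℕ
  rowHooks = map (boxHook (suc r) rs) (upTo (suc r))

descending-split : ∀ l {ls} → All (_≤ l) ls → Descending ls →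
  ∃₂ λ k ts → ls ≡ replicate k l ++ ts × All (_< l) ts × Descending ts
descending-split l {[]}     []           []              = 0 , [] , refl , [] , []
descending-split l {y ∷ ys} (y≤l ∷ ys≤l) (ys≤y ∷ desc) with m≤n⇒m<n∨m≡n y≤l
... | inj₁ y<l = 0 , y ∷ ys , refl , y<l ∷ All.map (λ z≤y → ≤-<-trans z≤y y<l) ys≤y , ys≤y ∷ desc
... | inj₂ refl with descending-split l ys≤l desc
...   | k , ts , refl , ts<l , desc-ts = suc k , ts , refl , ts<l , desc-ts

complementDiagram-split : ∀ l k ts → All (_< l) ts →
  complementDiagram (l ∷ replicate k l ++ ts) ≡ reverse (map (l ∸_) ts)
complementDiagram-split l k ts ts<l = begin
  filterᵇ (0 <ᵇ_) (reverse (map (l ∸_) (replicate (suc k) l ++ ts)))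
    ≡⟨ cong (filterᵇ (0 <ᵇ_) ∘ reverse) (map-++ (l ∸_) (replicate (suc k) l) ts) ⟩
  filterᵇ (0 <ᵇ_) (reverse (map (l ∸_) (replicate (suc k) l) ++ M))
    ≡⟨ cong (λ zs → filterᵇ (0 <ᵇ_) (reverse (zs ++ M))) emptyRows ⟩
  filterᵇ (0 <ᵇ_) (reverse (zeros ++ M))
    ≡⟨ cong (filterᵇ (0 <ᵇ_)) (reverse-++ zeros M) ⟩
  filterᵇ (0 <ᵇ_) (reverse M ++ reverse zeros)
    ≡⟨ filter-++ (T? ∘ (0 <ᵇ_)) (reverse M) (reverse zeros) ⟩
  filterᵇ (0 <ᵇ_) (reverse M) ++ filterᵇ (0 <ᵇ_) (reverse zeros)
    ≡⟨ cong₂ _++_ (filter-all (T? ∘ (0 <ᵇ_)) (All-reverse positive))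
                  (filter-none (T? ∘ (0 <ᵇ_)) (All-reverse (All.replicate⁺ (suc k) λ ()))) ⟩
  reverse M ++ []
    ≡⟨ ++-identityʳ (reverse M) ⟩
  reverse M ∎
  where
  open ≡-Reasoning
  M : List ℕ
  M = map (l ∸_) ts
  zeros : List ℕ
  zeros = replicate (suc k) 0
  emptyRows : map (l ∸_) (replicate (suc k) l) ≡ zeros
  emptyRows = trans (map-replicate (l ∸_) (suc k) l) (cong (replicate (suc k)) (n∸n≡0 l))
  positive : All (T ∘ (0 <ᵇ_)) M
  positive = All.map⁺ (All.map (<⇒<ᵇ ∘ m<n⇒0<n∸m) ts<l)

complementDiagram-isPartition : ∀ {D} → IsPartition D → IsPartition (complementDiagram D)
complementDiagram-isPartition {[]}     _                    = [] , []
complementDiagram-isPartition {l ∷ ls} ((ls≤l ∷ desc) , _)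
  with k , ts , refl , ts<l , desc-ts ← descending-split l ls≤l desc
  rewrite complementDiagram-split l k ts ts<l =
    AllPairs-reverse (AllPairs.map⁺ (AllPairs.map (∸-monoʳ-≤ l) desc-ts))
  , All-reverse (All.map⁺ (All.map m<n⇒0<n∸m ts<l))

-- Reflecting in l turns the jumps of l, ts, 0 into those of 0, l ∸ ts, l, the last of which
-- is the lost corner; and 0, l ∸ ts is the new diagram read bottom-up.
corners-complementDiagram : ∀ {D} → IsPartition D → corners (complementDiagram D) ≡ pred (corners D)
corners-complementDiagram {[]}     _                            = refl
corners-complementDiagram {l ∷ ls} ((ls≤l ∷ desc) , (1≤l ∷ pos))
  with k , ts , refl , ts<l , _ ← descending-split l ls≤l desc = begin
  corners (complementDiagram (l ∷ replicate k l ++ ts))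
    ≡⟨ cong corners (complementDiagram-split l k ts ts<l) ⟩
  corners (reverse M)
    ≡⟨ corners≡jumps-reverse (reverse M) ⟩
  jumps 0 (reverse (reverse M))
    ≡⟨ cong (jumps 0) (reverse-involutive M) ⟩
  jumps 0 M
    ≡⟨ cong pred (jumps-∷ʳ-fresh fresh) ⟨
  pred (jumps 0 (M ∷ʳ l))
    ≡⟨ cong₂ (λ p xs → pred (jumps p xs)) (n∸n≡0 l) (map-++ (l ∸_) ts (0 ∷ [])) ⟨
  pred (jumps (l ∸ l) (map (l ∸_) (ts ∷ʳ 0)))
    ≡⟨ cong pred (jumps-map (l ∸_) reflect-injective ≤-refl (All.∷ʳ⁺ (All.map <⇒≤ ts<l) z≤n)) ⟩
  pred (jumps l (ts ∷ʳ 0))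
    ≡⟨ cong pred (jumps-replicate l k (ts ∷ʳ 0)) ⟨
  pred (jumps l (replicate k l ++ ts ∷ʳ 0))
    ≡⟨ cong (pred ∘ jumps l) (++-assoc (replicate k l) ts (0 ∷ [])) ⟨
  pred (jumps l ((replicate k l ++ ts) ∷ʳ 0))
    ≡⟨ cong pred (corners-∷≡jumps l (replicate k l ++ ts)) ⟨
  pred (corners (l ∷ replicate k l ++ ts)) ∎
  where
  open ≡-Reasoning
  M : List ℕ
  M = map (l ∸_) ts
  reflect-injective : ∀ {m n} → m ≤ l → n ≤ l → l ∸ m ≡ l ∸ n → m ≡ n
  reflect-injective m≤l n≤l e = trans (sym (m∸[m∸n]≡n m≤l)) (trans (cong (l ∸_) e) (m∸[m∸n]≡n n≤l))
  fresh : All (_≢ l) (0 ∷ M)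
  fresh = <⇒≢ 1≤l
        ∷ All.map⁺ (All.zipWith (λ (t<l , 1≤t) → <⇒≢ (∸-monoʳ-< 1≤t (<⇒≤ t<l)))
                                (ts<l , All.++⁻ʳ (replicate k l) pos))

length-filterᵇ-not : ∀ {A : Set} (p : A → Bool) xs →
  length (filterᵇ p xs) + length (filterᵇ (not ∘ p) xs) ≡ length xs
length-filterᵇ-not p []       = refl
length-filterᵇ-not p (x ∷ xs) with p x
... | true  = cong suc (length-filterᵇ-not p xs)
... | false = trans (+-suc _ _) (cong suc (length-filterᵇ-not p xs))

gapsBelow : NumericalSet → ℕ → List ℕ
gapsBelow S ℓ = filterᵇ (not ∘ mem S) (upTo ℓ)

countBelow+gapsBelow : ∀ S ℓ → countBelow S ℓ + length (gapsBelow S ℓ) ≡ ℓ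
countBelow+gapsBelow S ℓ = trans (length-filterᵇ-not (mem S) (upTo ℓ)) (length-upTo ℓ)

countBelow-suc : ∀ S n → countBelow S n ≤ countBelow S (suc n)
countBelow-suc S n = begin
  countBelow S n
    ≤⟨ m≤m+n (countBelow S n) _ ⟩
  countBelow S n + length (filterᵇ (mem S) (n ∷ []))
    ≡⟨ length-++ (filterᵇ (mem S) (upTo n)) ⟨
  length (filterᵇ (mem S) (upTo n) ++ filterᵇ (mem S) (n ∷ []))
    ≡⟨ cong length (filter-++ (T? ∘ mem S) (upTo n) (n ∷ [])) ⟨
  length (filterᵇ (mem S) (upTo n ∷ʳ n))
    ≡⟨ cong (length ∘ filterᵇ (mem S)) (upTo-∷ʳ n) ⟩
  countBelow S (suc n) ∎
  where open ≤-Reasoning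

countBelow-mono : ∀ S {m n} → m ≤ n → countBelow S m ≤ countBelow S n
countBelow-mono S {n = zero}  z≤n = ≤-refl
countBelow-mono S {n = suc n} m≤1+n with m≤n⇒m<n∨m≡n m≤1+n
... | inj₁ (s≤s m≤n) = ≤-trans (countBelow-mono S m≤n) (countBelow-suc S n)
... | inj₂ refl      = ≤-refl

countBelow-gap : ∀ S {ℓ} → T (not (mem S ℓ)) → 1 ≤ countBelow S ℓ
countBelow-gap S {zero}  gap = case subst (T ∘ not) (mem0 S) gap of λ ()
countBelow-gap S {suc k} _   =
  subst (λ xs → 1 ≤ length xs) (sym (filter-accept (T? ∘ mem S) (subst T (sym (mem0 S)) _))) (s≤s z≤n)

upTo-increasing : ∀ n → AllPairs _<_ (upTo n)
upTo-increasing n = AllPairs.applyUpTo⁺₁ id n (λ i<j _ → i<j)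

young-isPartition : ∀ S → IsPartition (young S)
young-isPartition S =
    AllPairs.map⁺ (AllPairs.map (countBelow-mono S ∘ <⇒≤)
      (AllPairs-reverse (AllPairs.filter⁺ (T? ∘ not ∘ mem S) (upTo-increasing (bound S)))))
  , All.map⁺ (All.map (countBelow-gap S) (All-reverse (All.all-filter (T? ∘ not ∘ mem S) (upTo (bound S)))))

young≡[]⇒IsℕSet : ∀ S → young S ≡ [] → IsℕSet S
young≡[]⇒IsℕSet S noRows n with bound S ≤? n
... | yes bound≤n = cofinite S n bound≤n
... | no  bound≰n with mem S n in mem≡
...   | true  = refl
...   | false = contradiction (sym noGaps) (<⇒≢ (filter-some (T? ∘ not ∘ mem S) nIsGap))
  where
  nIsGap : Any (T ∘ not ∘ mem S) (upTo (bound S))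
  nIsGap = lose (∈-upTo⁺ (≰⇒> bound≰n)) (subst (T ∘ not) (sym mem≡) _)
  noGaps : length (gapsBelow S (bound S)) ≡ 0
  noGaps = begin
    length (gapsBelow S (bound S))            ≡⟨ length-reverse (gapsBelow S (bound S)) ⟨
    length (gapsDesc S)                       ≡⟨ length-map (countBelow S) (gapsDesc S) ⟨
    length (young S)                          ≡⟨ cong length noRows ⟩
    0                                         ∎
    where open ≡-Reasoning

rank : List ℕ → ℕ → ℕ
rank G ℓ = length (filterᵇ (_<ᵇ ℓ) G)

filterᵇ-<ᵇ-none : ∀ {ℓ G} → All (ℓ ≤_) G → filterᵇ (_<ᵇ ℓ) G ≡ []
filterᵇ-<ᵇ-none {ℓ} = filter-none (T? ∘ (_<ᵇ ℓ)) ∘ All.map (λ ℓ≤x x<ℓ → ≤⇒≯ ℓ≤x (<ᵇ⇒< _ ℓ x<ℓ))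

rank-element : ∀ pre g post → AllPairs _<_ (pre ++ g ∷ post) → rank (pre ++ g ∷ post) g ≡ length pre
rank-element []        g post (g<post ∷ _)
  rewrite <ᵇ-false (≤-refl {g}) | filterᵇ-<ᵇ-none (All.map <⇒≤ g<post) = refl
rank-element (x ∷ pre) g post (x<rest ∷ inc) with x<g ∷ _ ← All.++⁻ʳ pre x<rest
  rewrite <ᵇ-true x<g = cong suc (rank-element pre g post inc)

elemᵇ-< : ∀ {b xs} → All (b <_) xs → elemᵇ b xs ≡ false
elemᵇ-< []                     = refl
elemᵇ-< {b} (b<x ∷ b<xs) rewrite ≡ᵇ-false (<⇒≢ b<x) = elemᵇ-< b<xs

filterᵇ-singleton : ∀ (p : ℕ → Bool) b → filterᵇ p (b ∷ []) ≡ (if p b then b ∷ [] else [])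
filterᵇ-singleton p b with p b
... | true  = refl
... | false = refl

filterᵇ-<ᵇ-suc : ∀ b {G} → AllPairs _<_ G →
  filterᵇ (_<ᵇ suc b) G ≡ filterᵇ (_<ᵇ b) G ++ (if elemᵇ b G then b ∷ [] else [])
filterᵇ-<ᵇ-suc b {[]}     []              = refl
filterᵇ-<ᵇ-suc b {x ∷ G} (x<G ∷ inc) with <-cmp x b
... | tri< x<b _ _
  rewrite <ᵇ-true (m<n⇒m<1+n x<b) | <ᵇ-true x<b | ≡ᵇ-false (≢-sym (<⇒≢ x<b)) =
    cong (x ∷_) (filterᵇ-<ᵇ-suc b inc)
... | tri≈ _ refl _
  rewrite <ᵇ-true (n<1+n x) | <ᵇ-false (≤-refl {x}) | ≡ᵇ-refl x
        | filterᵇ-<ᵇ-none x<G | filterᵇ-<ᵇ-none (All.map <⇒≤ x<G) = refl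
... | tri> _ _ b<x
  rewrite <ᵇ-false {x} {suc b} b<x | <ᵇ-false (<⇒≤ b<x) | ≡ᵇ-false (<⇒≢ b<x)
        | filterᵇ-<ᵇ-none (All.map (<-trans b<x) x<G)
        | filterᵇ-<ᵇ-none (All.map (<⇒≤ ∘ <-trans b<x) x<G)
        | elemᵇ-< (All.map (<-trans b<x) x<G) = refl

filterᵇ-elemᵇ-upTo : ∀ {G} → AllPairs _<_ G → ∀ b → filterᵇ (λ n → elemᵇ n G) (upTo b) ≡ filterᵇ (_<ᵇ b) G
filterᵇ-elemᵇ-upTo {G} inc zero = sym (filterᵇ-<ᵇ-none (All.universal (λ _ → z≤n) G))
filterᵇ-elemᵇ-upTo {G} inc (suc b) = begin
  filterᵇ (λ n → elemᵇ n G) (upTo (suc b))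
    ≡⟨ cong (filterᵇ (λ n → elemᵇ n G)) (upTo-∷ʳ b) ⟨
  filterᵇ (λ n → elemᵇ n G) (upTo b ∷ʳ b)
    ≡⟨ filter-++ (T? ∘ λ n → elemᵇ n G) (upTo b) (b ∷ []) ⟩
  filterᵇ (λ n → elemᵇ n G) (upTo b) ++ filterᵇ (λ n → elemᵇ n G) (b ∷ [])
    ≡⟨ cong₂ _++_ (filterᵇ-elemᵇ-upTo inc b) (filterᵇ-singleton (λ n → elemᵇ n G) b) ⟩
  filterᵇ (_<ᵇ b) G ++ (if elemᵇ b G then b ∷ [] else [])
    ≡⟨ filterᵇ-<ᵇ-suc b inc ⟨
  filterᵇ (_<ᵇ suc b) G ∎
  where open ≡-Reasoning

All-≤-maxL : ∀ G → All (_≤ maxL G) G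
All-≤-maxL []       = []
All-≤-maxL (x ∷ xs) = m≤m⊔n x (maxL xs) ∷ All.map (λ y≤max → ≤-trans y≤max (m≤n⊔m x (maxL xs))) (All-≤-maxL xs)

elemᵇ-0 : ∀ {xs} → All (1 ≤_) xs → elemᵇ 0 xs ≡ false
elemᵇ-0 []             = refl
elemᵇ-0 (s≤s _ ∷ pos) = elemᵇ-0 pos

module FromGaps (G : List ℕ) (increasing : AllPairs _<_ G) (positive : All (1 ≤_) G) where

  S : NumericalSet
  S = fromGaps G

  not-mem : ∀ n → not (mem S n) ≡ elemᵇ n G
  not-mem zero    = sym (elemᵇ-0 positive)
  not-mem (suc n) = not-involutive (elemᵇ (suc n) G)

  gapsBelow-fromGaps : ∀ ℓ → gapsBelow S ℓ ≡ filterᵇ (_<ᵇ ℓ) G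
  gapsBelow-fromGaps ℓ =
    trans (filter-≐ (T? ∘ not ∘ mem S) (T? ∘ λ n → elemᵇ n G)
                    ((λ {n} → subst T (not-mem n)) , (λ {n} → subst T (sym (not-mem n)))) (upTo ℓ))
          (filterᵇ-elemᵇ-upTo increasing ℓ)

  gapsDesc-fromGaps : gapsDesc S ≡ reverse G
  gapsDesc-fromGaps = cong reverse (trans (gapsBelow-fromGaps (suc (maxL G)))
    (filter-all (T? ∘ (_<ᵇ suc (maxL G))) (All.map (<⇒<ᵇ ∘ s≤s) (All-≤-maxL G))))

  countBelow-fromGaps : ∀ ℓ → countBelow S ℓ ≡ ℓ ∸ rank G ℓ
  countBelow-fromGaps ℓ = begin
    countBelow S ℓ                      ≡⟨ m+n∸n≡m (countBelow S ℓ) (length gaps) ⟨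
    countBelow S ℓ + length gaps ∸ length gaps ≡⟨ cong (_∸ length gaps) (countBelow+gapsBelow S ℓ) ⟩
    ℓ ∸ length gaps                     ≡⟨ cong (λ gs → ℓ ∸ length gs) (gapsBelow-fromGaps ℓ) ⟩
    ℓ ∸ rank G ℓ                        ∎
    where
    open ≡-Reasoning
    gaps : List ℕ
    gaps = gapsBelow S ℓ

gapsFromBottomUp-≥ : ∀ {a} j {μs} → All (a ≤_) μs → All (a + j ≤_) (gapsFromBottomUp j μs)
gapsFromBottomUp-≥     j []            = []
gapsFromBottomUp-≥ {a} j (a≤μ ∷ a≤μs) =
  +-monoˡ-≤ j a≤μ ∷ All.map (≤-trans (+-monoʳ-≤ a (n≤1+n j))) (gapsFromBottomUp-≥ (suc j) a≤μs)

gapsFromBottomUp-increasing : ∀ j {μs} → AllPairs _≤_ μs → AllPairs _<_ (gapsFromBottomUp j μs)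
gapsFromBottomUp-increasing j            []            = []
gapsFromBottomUp-increasing j {μ ∷ _} (μ≤μs ∷ asc) =
    All.map (λ {g} → subst (_≤ g) (+-suc μ j)) (gapsFromBottomUp-≥ (suc j) μ≤μs)
  ∷ gapsFromBottomUp-increasing (suc j) asc

-- The gap μⱼ + j has exactly j gaps below it, hence μⱼ elements of the set below it.
gapsFromBottomUp-rows : ∀ {G} pre j νs → AllPairs _<_ G →
  G ≡ pre ++ gapsFromBottomUp j νs → length pre ≡ j →
  map (λ ℓ → ℓ ∸ rank G ℓ) (gapsFromBottomUp j νs) ≡ νs
gapsFromBottomUp-rows pre j []       _   _    _     = refl
gapsFromBottomUp-rows pre j (ν ∷ νs) inc refl |pre| = cong₂ _∷_ row rows
  where
  rest : List ℕ
  rest = gapsFromBottomUp (suc j) νs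
  row : ν + j ∸ rank (pre ++ ν + j ∷ rest) (ν + j) ≡ ν
  row = trans (cong (ν + j ∸_) (trans (rank-element pre (ν + j) rest inc) |pre|)) (m+n∸n≡m ν j)
  rows : map (λ ℓ → ℓ ∸ rank (pre ++ ν + j ∷ rest) ℓ) rest ≡ νs
  rows = gapsFromBottomUp-rows (pre ∷ʳ (ν + j)) (suc j) νs inc
           (sym (++-assoc pre (ν + j ∷ []) rest))
           (trans (length-++ pre) (trans (cong (_+ 1) |pre|) (+-comm j 1)))

young-fromDiagram : ∀ {D} → IsPartition D → young (fromDiagram D) ≡ D
young-fromDiagram {D} (desc , pos) = begin
  map (countBelow S) (gapsDesc S)          ≡⟨ cong (map (countBelow S)) gapsDesc-fromGaps ⟩
  map (countBelow S) (reverse G)           ≡⟨ reverse-map (countBelow S) G ⟩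
  reverse (map (countBelow S) G)           ≡⟨ cong reverse (map-cong countBelow-fromGaps G) ⟩
  reverse (map (λ ℓ → ℓ ∸ rank G ℓ) G)     ≡⟨ cong reverse (gapsFromBottomUp-rows [] 0 (reverse D) increasing refl refl) ⟩
  reverse (reverse D)                      ≡⟨ reverse-involutive D ⟩
  D                                        ∎
  where
  open ≡-Reasoning
  G : List ℕ
  G = gapsOfDiagram D
  increasing : AllPairs _<_ G
  increasing = gapsFromBottomUp-increasing 0 (AllPairs-reverse desc)
  open FromGaps G increasing (gapsFromBottomUp-≥ 0 (All-reverse pos))

young-complement : ∀ S → young (complement S) ≡ complementDiagram (young S)
young-complement S = young-fromDiagram (complementDiagram-isPartition (young-isPartition S))

corners-iterComplement : ∀ k S → corners (young (iterComplement k S)) ≡ corners (young S) ∸ k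
corners-iterComplement zero    S = refl
corners-iterComplement (suc k) S = begin
  corners (young (complement Sₖ))            ≡⟨ cong corners (young-complement Sₖ) ⟩
  corners (complementDiagram (young Sₖ))     ≡⟨ corners-complementDiagram (young-isPartition Sₖ) ⟩
  pred (corners (young Sₖ))                  ≡⟨ cong pred (corners-iterComplement k S) ⟩
  pred (corners (young S) ∸ k)               ≡⟨ pred[m∸n]≡m∸[1+n] (corners (young S)) k ⟩
  corners (young S) ∸ suc k                  ∎
  where
  open ≡-Reasoning
  Sₖ : NumericalSet
  Sₖ = iterComplement k S

corollary5p2 : (S : NumericalSet) → IsℕSet (iterComplement (c₁ S) S)
corollary5p2 S = young≡[]⇒IsℕSet Sₙ (corners≡0⇒≡[] (proj₂ (young-isPartition Sₙ)) noCorners)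
  where
  n : ℕ
  n = c₁ S
  Sₙ : NumericalSet
  Sₙ = iterComplement n S
  noCorners : corners (young Sₙ) ≡ 0
  noCorners = begin
    corners (young Sₙ)                      ≡⟨ corners-iterComplement n S ⟩
    corners (young S) ∸ n                   ≡⟨ cong (corners (young S) ∸_) (hookOnes≡corners (young-isPartition S)) ⟩
    corners (young S) ∸ corners (young S)   ≡⟨ n∸n≡0 (corners (young S)) ⟩
    0                                       ∎
    where open ≡-Reasoning
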